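{- Let $t\ge1$ and let $x_1,x_2,\dots,x_t$ be non-negative real numbers such that $x_i\le 2x_j$ for all $i,j\in\{1,\dots,t\}$, and let $C=\sum_{i=1}^t x_i$. Then $\sum_{i=1}^t x_i^2\le \frac{9}{8}\cdot\frac{C^2}{t}$. -}

module Defs where

open import Level using (Level; _⊔_) renaming (suc to lsuc)
open import Algebra.Bundles using (CommutativeRing)
open import Relation.Binary.Core using (Rel)
open import Relation.Binary.Structures using (IsTotalOrder)
open import Relation.Nullary using (¬_)
open import Data.Product using (∃; _×_)
open import Data.Nat using (ℕ; zero; suc)
open import Data.Fin using (Fin)
import Data.Fin as Fin

-- An axiomatic model of the real numbers: a complete (Dedekind/sup-complete)
-- totally ordered field.  Any such structure is (classically) isomorphic to ℝ.
record RealField (c ℓ : Level) : Set (lsuc (c ⊔ ℓ)) where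
  field
    commutativeRing : CommutativeRing c ℓ
  open CommutativeRing commutativeRing public
  infix 4 _≤_
  field
    _≤_          : Rel Carrier ℓ
    isTotalOrder : IsTotalOrder _≈_ _≤_
    +-monoˡ-≤    : ∀ {x y} z → x ≤ y → x + z ≤ y + z
    *-nonneg     : ∀ {x y} → 0# ≤ x → 0# ≤ y → 0# ≤ x * y
    0≉1          : ¬ (0# ≈ 1#)
    inverse      : ∀ x → ¬ (x ≈ 0#) → ∃ λ y → x * y ≈ 1#
    sup          : (P : Carrier → Set ℓ) → ∃ P → (∃ λ b → ∀ x → P x → x ≤ b) →
                   ∃ λ s → (∀ x → P x → x ≤ s) × (∀ b → (∀ x → P x → x ≤ b) → s ≤ b)

  ι : ℕ → Carrier
  ι zero    = 0#
  ι (suc n) = 1# + ι n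

  Σ : ∀ {t} → (Fin t → Carrier) → Carrier
  Σ {zero}  f = 0#
  Σ {suc t} f = f Fin.zero + Σ (λ i → f (Fin.suc i))

module Submission where

open import Defs
open import Level using (Level)
open import Data.Nat using (ℕ; zero; suc)
open import Data.Fin using (Fin; zero; suc)
import Data.Nat as Nat
open import Data.Product using (∃; _×_; _,_)
open import Data.Sum using (inj₁; inj₂)
open import Data.Maybe using (nothing)
open import Function using (id)
open import Relation.Binary.Bundles using (TotalOrder)
open import Relation.Binary.Structures using (IsTotalOrder)
open import Relation.Binary.PropositionalEquality using (_≡_)
open import Algebra using (RawRing)
open import Algebra.Solver.Ring.AlmostCommutativeRing
  using (fromCommutativeSemiring; _-Raw-AlmostCommutative⟶_)
import Algebra.Solver.Ring as RingSolver
import Algebra.Properties.Ring as RingProperties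
import Relation.Binary.Reasoning.PartialOrder as PosetReasoning

-- Let m be the smallest x i.  Every x i lies in [m, 2m], so (x i − m)(2m − x i) ≥ 0,
-- i.e. x i² + 2m² ≤ 3m x i; summing, S + 2tm² ≤ 3mC where S = Σ x i².  Hence
-- 8tS ≤ 24tmC − 16t²m² ≤ 9C², the last step being (3C − 4tm)² ≥ 0.

module RealFieldProperties {c ℓ : Level} (R : RealField c ℓ) where

  open RealField R hiding (zero)
  open IsTotalOrder isTotalOrder using (total) renaming (refl to ≤-refl; trans to ≤-trans)
  open RingProperties ring using (-1*x≈-x; -‿involutive)

  totalOrder : TotalOrder c ℓ ℓ
  totalOrder = record { isTotalOrder = isTotalOrder }

  open PosetReasoning (TotalOrder.poset totalOrder)

  ι-+ : ∀ m n → ι (m Nat.+ n) ≈ ι m + ι n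
  ι-+ zero    n = sym (+-identityˡ (ι n))
  ι-+ (suc m) n = trans (+-congˡ (ι-+ m n)) (sym (+-assoc 1# (ι m) (ι n)))

  ι-* : ∀ m n → ι (m Nat.* n) ≈ ι m * ι n
  ι-* zero    n = sym (zeroˡ (ι n))
  ι-* (suc m) n = begin-equality
    ι (n Nat.+ m Nat.* n)  ≈⟨ ι-+ n (m Nat.* n) ⟩
    ι n + ι (m Nat.* n)    ≈⟨ +-cong (sym (*-identityˡ (ι n))) (ι-* m n) ⟩
    1# * ι n + ι m * ι n   ≈⟨ distribʳ (ι n) 1# (ι m) ⟨
    (1# + ι m) * ι n       ∎

  -- Solver coefficients, interpreted by ι so that numerals match ι-literals definitionally;
  -- the negation is a dummy, as every identity solved below is subtraction-free.
  ℕ-rawRing : RawRing Level.zero Level.zero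
  ℕ-rawRing = record
    { Carrier = ℕ ; _≈_ = _≡_ ; _+_ = Nat._+_ ; _*_ = Nat._*_
    ; -_ = id ; 0# = 0 ; 1# = 1 }

  ι-homomorphism : ℕ-rawRing -Raw-AlmostCommutative⟶ fromCommutativeSemiring commutativeSemiring
  ι-homomorphism = record
    { ⟦_⟧ = ι ; +-homo = ι-+ ; *-homo = ι-* ; -‿homo = λ _ → refl
    ; 0-homo = refl ; 1-homo = +-identityʳ 1# }

  open RingSolver ℕ-rawRing (fromCommutativeSemiring commutativeSemiring) ι-homomorphism (λ _ _ → nothing)
    using (solve; _:=_; con; _:+_; _:*_)

  +-monoʳ-≤ : ∀ {x y} z → x ≤ y → z + x ≤ z + y
  +-monoʳ-≤ {x} {y} z x≤y = begin
    z + x  ≈⟨ +-comm z x ⟩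
    x + z  ≤⟨ +-monoˡ-≤ z x≤y ⟩
    y + z  ≈⟨ +-comm y z ⟩
    z + y  ∎

  +-mono-≤ : ∀ {x y u v} → x ≤ y → u ≤ v → x + u ≤ y + v
  +-mono-≤ x≤y u≤v = ≤-trans (+-monoˡ-≤ _ x≤y) (+-monoʳ-≤ _ u≤v)

  x+y≥0 : ∀ {x y} → 0# ≤ x → 0# ≤ y → 0# ≤ x + y
  x+y≥0 {x} {y} x≥0 y≥0 = begin
    0#      ≈⟨ +-identityʳ 0# ⟨
    0# + 0# ≤⟨ +-mono-≤ x≥0 y≥0 ⟩
    x + y   ∎

  x+z-z≈x : ∀ x z → x + z + - z ≈ x
  x+z-z≈x x z = begin-equality
    x + z + - z    ≈⟨ +-assoc x z (- z) ⟩
    x + (z + - z)  ≈⟨ +-congˡ (-‿inverseʳ z) ⟩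
    x + 0#         ≈⟨ +-identityʳ x ⟩
    x              ∎

  +-cancelʳ-≤ : ∀ {x y} z → x + z ≤ y + z → x ≤ y
  +-cancelʳ-≤ {x} {y} z x+z≤y+z = begin
    x            ≈⟨ x+z-z≈x x z ⟨
    x + z + - z  ≤⟨ +-monoˡ-≤ (- z) x+z≤y+z ⟩
    y + z + - z  ≈⟨ x+z-z≈x y z ⟩
    y            ∎

  ≤⇒∃-nonneg-difference : ∀ {x y} → x ≤ y → ∃ λ d → 0# ≤ d × x + d ≈ y
  ≤⇒∃-nonneg-difference {x} {y} x≤y = y + - x , y-x≥0 , x+[y-x]≈y
    where
    y-x≥0 : 0# ≤ y + - x
    y-x≥0 = begin
      0#        ≈⟨ -‿inverseʳ x ⟨
      x + - x   ≤⟨ +-monoˡ-≤ (- x) x≤y ⟩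
      y + - x   ∎
    x+[y-x]≈y : x + (y + - x) ≈ y
    x+[y-x]≈y = begin-equality
      x + (y + - x)  ≈⟨ +-congˡ (+-comm y (- x)) ⟩
      x + (- x + y)  ≈⟨ +-assoc x (- x) y ⟨
      x + - x + y    ≈⟨ +-congʳ (-‿inverseʳ x) ⟩
      0# + y         ≈⟨ +-identityˡ y ⟩
      y              ∎

  nonneg-difference⇒≤ : ∀ {x y d} → 0# ≤ d → x + d ≈ y → x ≤ y
  nonneg-difference⇒≤ {x} {y} {d} d≥0 x+d≈y = begin
    x       ≈⟨ +-identityʳ x ⟨
    x + 0#  ≤⟨ +-monoʳ-≤ x d≥0 ⟩
    x + d   ≈⟨ x+d≈y ⟩
    y       ∎

  *-monoˡ-≤-nonneg : ∀ {x y z} → 0# ≤ z → x ≤ y → z * x ≤ z * y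
  *-monoˡ-≤-nonneg {x} {y} {z} z≥0 x≤y with ≤⇒∃-nonneg-difference x≤y
  ... | d , d≥0 , x+d≈y = nonneg-difference⇒≤ (*-nonneg z≥0 d≥0) (begin-equality
    z * x + z * d  ≈⟨ distribˡ z x d ⟨
    z * (x + d)    ≈⟨ *-congˡ x+d≈y ⟩
    z * y          ∎)

  0≤1 : 0# ≤ 1#
  0≤1 with total 0# 1#
  ... | inj₁ 0≤1 = 0≤1
  ... | inj₂ 1≤0 = begin
    0#          ≤⟨ *-nonneg 0≤-1 0≤-1 ⟩
    - 1# * - 1# ≈⟨ -1*x≈-x (- 1#) ⟩
    - - 1#      ≈⟨ -‿involutive 1# ⟩
    1#          ∎
    where
    0≤-1 : 0# ≤ - 1#
    0≤-1 = begin
      0#         ≈⟨ -‿inverseʳ 1# ⟨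
      1# + - 1#  ≤⟨ +-monoˡ-≤ (- 1#) 1≤0 ⟩
      0# + - 1#  ≈⟨ +-identityˡ (- 1#) ⟩
      - 1#       ∎

  0≤ι : ∀ n → 0# ≤ ι n
  0≤ι zero    = ≤-refl
  0≤ι (suc n) = x+y≥0 0≤1 (0≤ι n)

  x≤y⇒x*y+x*y≤x*x+y*y : ∀ {x y} → x ≤ y → x * y + x * y ≤ x * x + y * y
  x≤y⇒x*y+x*y≤x*x+y*y {x} {y} x≤y with ≤⇒∃-nonneg-difference x≤y
  ... | d , d≥0 , x+d≈y = nonneg-difference⇒≤ (*-nonneg d≥0 d≥0) (begin-equality
    x * y + x * y + d * d              ≈⟨ +-congʳ (+-cong (*-congˡ x+d≈y) (*-congˡ x+d≈y)) ⟨
    x * (x + d) + x * (x + d) + d * d  ≈⟨ solve 2 (λ x d → x :* (x :+ d) :+ x :* (x :+ d) :+ d :* d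
                                              := x :* x :+ (x :+ d) :* (x :+ d)) refl x d ⟩
    x * x + (x + d) * (x + d)          ≈⟨ +-congˡ (*-cong x+d≈y x+d≈y) ⟩
    x * x + y * y                      ∎)

  x*y+x*y≤x*x+y*y : ∀ x y → x * y + x * y ≤ x * x + y * y
  x*y+x*y≤x*x+y*y x y with total x y
  ... | inj₁ x≤y = x≤y⇒x*y+x*y≤x*x+y*y x≤y
  ... | inj₂ y≤x = begin
    x * y + x * y  ≈⟨ +-cong (*-comm x y) (*-comm x y) ⟩
    y * x + y * x  ≤⟨ x≤y⇒x*y+x*y≤x*x+y*y y≤x ⟩
    y * y + x * x  ≈⟨ +-comm (y * y) (x * x) ⟩
    x * x + y * y  ∎

  x*x+a*b≤[a+b]*x : ∀ {a b x} → a ≤ x → x ≤ b → x * x + a * b ≤ (a + b) * x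
  x*x+a*b≤[a+b]*x {a} {b} {x} a≤x x≤b
    with ≤⇒∃-nonneg-difference a≤x | ≤⇒∃-nonneg-difference x≤b
  ... | p , p≥0 , a+p≈x | q , q≥0 , x+q≈b = nonneg-difference⇒≤ (*-nonneg p≥0 q≥0) (begin-equality
    x * x + a * b + p * q                    ≈⟨ +-congʳ (+-cong (*-cong x≈a+p x≈a+p) (*-congˡ b≈a+p+q)) ⟩
    (a + p) * (a + p) + a * (a + p + q) + p * q
      ≈⟨ solve 3 (λ a p q → (a :+ p) :* (a :+ p) :+ a :* (a :+ p :+ q) :+ p :* q
                           := (a :+ (a :+ p :+ q)) :* (a :+ p)) refl a p q ⟩
    (a + (a + p + q)) * (a + p)              ≈⟨ *-cong (+-congˡ b≈a+p+q) x≈a+p ⟨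
    (a + b) * x                              ∎)
    where
    x≈a+p : x ≈ a + p
    x≈a+p = sym a+p≈x
    b≈a+p+q : b ≈ a + p + q
    b≈a+p+q = trans (sym x+q≈b) (+-congʳ x≈a+p)

  Σ-mono-≤ : ∀ {t} {f g : Fin t → Carrier} → (∀ i → f i ≤ g i) → Σ f ≤ Σ g
  Σ-mono-≤ {zero}  f≤g = ≤-refl
  Σ-mono-≤ {suc t} f≤g = +-mono-≤ (f≤g zero) (Σ-mono-≤ (λ i → f≤g (suc i)))

  Σ-+ : ∀ {t} (f g : Fin t → Carrier) → Σ (λ i → f i + g i) ≈ Σ f + Σ g
  Σ-+ {zero}  f g = sym (+-identityʳ 0#)
  Σ-+ {suc t} f g = begin-equality
    f zero + g zero + Σ (λ i → f (suc i) + g (suc i))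
      ≈⟨ +-congˡ (Σ-+ (λ i → f (suc i)) (λ i → g (suc i))) ⟩
    f zero + g zero + (Σ (λ i → f (suc i)) + Σ (λ i → g (suc i)))
      ≈⟨ solve 4 (λ a b c d → a :+ b :+ (c :+ d) := a :+ c :+ (b :+ d)) refl _ _ _ _ ⟩
    f zero + Σ (λ i → f (suc i)) + (g zero + Σ (λ i → g (suc i)))  ∎

  Σ-const : ∀ t y → Σ {t} (λ _ → y) ≈ ι t * y
  Σ-const zero    y = sym (zeroˡ y)
  Σ-const (suc t) y = begin-equality
    y + Σ {t} (λ _ → y)  ≈⟨ +-cong (sym (*-identityˡ y)) (Σ-const t y) ⟩
    1# * y + ι t * y     ≈⟨ distribʳ y 1# (ι t) ⟨
    (1# + ι t) * y       ∎

  *-distribˡ-Σ : ∀ {t} y (f : Fin t → Carrier) → y * Σ f ≈ Σ (λ i → y * f i)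
  *-distribˡ-Σ {zero}  y f = zeroʳ y
  *-distribˡ-Σ {suc t} y f =
    trans (distribˡ y (f zero) _) (+-congˡ (*-distribˡ-Σ y (λ i → f (suc i))))

  Σ[x*x]+ι[t]*[a*b]≤[a+b]*Σx : ∀ {t a b} (x : Fin t → Carrier) →
    (∀ i → a ≤ x i) → (∀ i → x i ≤ b) → Σ (λ i → x i * x i) + ι t * (a * b) ≤ (a + b) * Σ x
  Σ[x*x]+ι[t]*[a*b]≤[a+b]*Σx {t} {a} {b} x a≤x x≤b = begin
    Σ (λ i → x i * x i) + ι t * (a * b)       ≈⟨ +-congˡ (Σ-const t (a * b)) ⟨
    Σ (λ i → x i * x i) + Σ {t} (λ _ → a * b) ≈⟨ Σ-+ (λ i → x i * x i) (λ _ → a * b) ⟨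
    Σ (λ i → x i * x i + a * b)               ≤⟨ Σ-mono-≤ (λ i → x*x+a*b≤[a+b]*x (a≤x i) (x≤b i)) ⟩
    Σ (λ i → (a + b) * x i)                   ≈⟨ *-distribˡ-Σ (a + b) x ⟨
    (a + b) * Σ x                             ∎

  ∃-minimum : ∀ {n} (x : Fin (suc n) → Carrier) → ∃ λ k → ∀ i → x k ≤ x i
  ∃-minimum {zero}  x = zero , λ { zero → ≤-refl }
  ∃-minimum {suc n} x with ∃-minimum (λ i → x (suc i))
  ... | k , min with total (x zero) (x (suc k))
  ... | inj₁ x₀≤xₖ = zero  , λ { zero → ≤-refl ; (suc i) → ≤-trans x₀≤xₖ (min i) }
  ... | inj₂ xₖ≤x₀ = suc k , λ { zero → xₖ≤x₀  ; (suc i) → min i }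

  Σ[x*x]-bound-on-[m,2m] : ∀ {t} m (x : Fin t → Carrier) → (∀ i → m ≤ x i) → (∀ i → x i ≤ ι 2 * m) →
    ι 8 * ι t * Σ (λ i → x i * x i) ≤ ι 9 * (Σ x * Σ x)
  Σ[x*x]-bound-on-[m,2m] {t} m x m≤x x≤2m = +-cancelʳ-≤ (ι 8 * T * (T * (m * (ι 2 * m)))) (begin
    ι 8 * T * S + ι 8 * T * (T * (m * (ι 2 * m)))  ≈⟨ distribˡ (ι 8 * T) S _ ⟨
    ι 8 * T * (S + T * (m * (ι 2 * m)))            ≤⟨ *-monoˡ-≤-nonneg 0≤8T (Σ[x*x]+ι[t]*[a*b]≤[a+b]*Σx x m≤x x≤2m) ⟩
    ι 8 * T * ((m + ι 2 * m) * C)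
      ≈⟨ solve 3 (λ T m C → con 8 :* T :* ((m :+ con 2 :* m) :* C)
                           := con 4 :* T :* m :* (con 3 :* C) :+ con 4 :* T :* m :* (con 3 :* C)) refl T m C ⟩
    ι 4 * T * m * (ι 3 * C) + ι 4 * T * m * (ι 3 * C)  ≤⟨ x*y+x*y≤x*x+y*y (ι 4 * T * m) (ι 3 * C) ⟩
    ι 4 * T * m * (ι 4 * T * m) + ι 3 * C * (ι 3 * C)
      ≈⟨ solve 3 (λ T m C → con 4 :* T :* m :* (con 4 :* T :* m) :+ con 3 :* C :* (con 3 :* C)
                           := con 9 :* (C :* C) :+ con 8 :* T :* (T :* (m :* (con 2 :* m)))) refl T m C ⟩
    ι 9 * (C * C) + ι 8 * T * (T * (m * (ι 2 * m)))  ∎)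
    where
    T = ι t
    S = Σ (λ i → x i * x i)
    C = Σ x
    0≤8T : 0# ≤ ι 8 * T
    0≤8T = *-nonneg (0≤ι 8) (0≤ι t)

lemma4 : {c ℓ : Level} (R : RealField c ℓ) → let open RealField R in
    (t : ℕ) → 1 Nat.≤ t → (x : Fin t → Carrier) →
    (∀ i → 0# ≤ x i) → (∀ i j → x i ≤ ι 2 * x j) →
    ι 8 * ι t * Σ (λ i → x i * x i) ≤ ι 9 * (Σ x * Σ x)
lemma4 R (suc n) _ x _ x≤2x =
  let (k , xₖ≤x) = ∃-minimum x in Σ[x*x]-bound-on-[m,2m] (x k) x xₖ≤x (λ i → x≤2x i k)
  where open RealFieldProperties R
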